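{- Let $n\ge1$, let $z_1,\dots,z_n$ be distinct integers none of which equals $1$ or $-1$, and let $D=\{1,-1,z_1,\dots,z_n\}$. Then $diam(D)=2$ if $n=1$, $diam(D)=3$ if $n=2$, and $diam(D)=4$ if $n>2$.
   Context: A signed tree is a pair $(T,s)$ with $T$ a finite tree and $s:E(T)\to\{+,-\}$. The signed degree $sdeg(v)$ of a vertex is the number of incident positive edges minus the number of incident negative edges. $(T,s)$ realizes $D$ if $D=\{sdeg(v):v\in V(T)\}$. For a set $D$ of integers containing $1$ or $-1$, $diam(D)$ is the minimum of $diam(T)$ over all signed trees $(T,s)$ that realize $D$. -}

module Defs where

open import Data.Nat using (ℕ; zero; suc; _≤_)
open import Data.Fin using (Fin; zero; suc)
open import Data.Integer using (ℤ; _+_; 0ℤ; 1ℤ; -1ℤ)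
open import Data.Maybe using (Maybe; just; nothing)
open import Data.Sign using (Sign)
open import Data.List using (List; []; _∷_; _++_)
open import Data.List.Relation.Unary.Linked using (Linked)
open import Data.List.Relation.Unary.Unique.Propositional using (Unique)
open import Data.List.Membership.Propositional using (_∈_)
open import Data.Product using (Σ; ∃; _×_)
open import Relation.Binary.PropositionalEquality using (_≡_)
open import Relation.Nullary using (¬_)
open import Function.Bundles using (_⇔_)

sumFin : ∀ {k} → (Fin k → ℤ) → ℤ
sumFin {zero}  f = 0ℤ
sumFin {suc k} f = f zero + sumFin (λ i → f (suc i))

-- A finite simple graph on vertex set Fin k whose edges carry a sign:
-- lab u v = just s  iff  {u,v} is an edge with sign s; nothing if no edge.
record SignedGraph (k : ℕ) : Set where
  field
    lab    : Fin k → Fin k → Maybe Sign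
    sym    : ∀ u v → lab u v ≡ lab v u
    irrefl : ∀ v → lab v v ≡ nothing
open SignedGraph public

Adj : ∀ {k} → SignedGraph k → Fin k → Fin k → Set
Adj G u v = ∃ λ s → lab G u v ≡ just s

signVal : Maybe Sign → ℤ
signVal nothing        = 0ℤ
signVal (just Sign.+)  = 1ℤ
signVal (just Sign.-)  = -1ℤ

sdeg : ∀ {k} → SignedGraph k → Fin k → ℤ
sdeg G v = sumFin (λ u → signVal (lab G v u))

data Walk {k} (G : SignedGraph k) : Fin k → Fin k → ℕ → Set where
  nil  : ∀ {u} → Walk G u u 0
  cons : ∀ {u w v ℓ} → Adj G u w → Walk G w v ℓ → Walk G u v (suc ℓ)

Connected : ∀ {k} → SignedGraph k → Set
Connected G = ∀ u v → ∃ λ ℓ → Walk G u v ℓ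

HasCycle : ∀ {k} → SignedGraph k → Set
HasCycle {k} G =
  Σ (Fin k) λ x → Σ (Fin k) λ y → Σ (Fin k) λ z → Σ (List (Fin k)) λ rest →
    Unique (x ∷ y ∷ z ∷ rest) × Linked (Adj G) ((x ∷ y ∷ z ∷ rest) ++ (x ∷ []))

IsTree : ∀ {k} → SignedGraph k → Set
IsTree {k} G = (1 ≤ k) × Connected G × ¬ HasCycle G

HasDiameter : ∀ {k} → SignedGraph k → ℕ → Set
HasDiameter G d =
  (∀ u v → ∃ λ ℓ → (ℓ ≤ d) × Walk G u v ℓ) ×
  (∃ λ u → ∃ λ v → ∀ ℓ → Walk G u v ℓ → d ≤ ℓ)

Realizes : ∀ {k} → SignedGraph k → List ℤ → Set
Realizes {k} G D = ∀ x → (x ∈ D) ⇔ (∃ λ (v : Fin k) → sdeg G v ≡ x)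

DiamIs : List ℤ → ℕ → Set
DiamIs D d =
  (Σ ℕ λ k → Σ (SignedGraph k) λ G → IsTree G × Realizes G D × HasDiameter G d) ×
  (∀ k (G : SignedGraph k) e → IsTree G → Realizes G D → HasDiameter G e → d ≤ e)

{-# OPTIONS --safe #-}
-- A vertex whose signed degree is not ±1 cannot be a leaf (a leaf has degree ±1), so in a tree realizing D
-- each z_i sits at a vertex with two distinct neighbours. Extending paths through such vertices by a further
-- neighbour, one of them forces diameter ≥ 2, two force ≥ 3 with equality only if they are adjacent, and
-- three would then be pairwise adjacent, a triangle, so three force ≥ 4. Conversely, take a root joined to
-- hubs for z_2, …, z_n and give the root and every hub extra leaves of both signs that bring their signed
-- degrees to z_1 and z_i: this tree realizes D, and every vertex lies within distance 1 of the root if n = 1,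
-- within 1 of the root or of the single hub if n = 2, and within 2 of the root in general.
module Submission where

open import Defs
open import Data.Nat as ℕ using (ℕ; zero; suc; _≤_; _<_; z≤n; s≤s; _≤?_)
import Data.Nat.Properties as ℕₚ
open import Data.Fin using (Fin; zero; suc; toℕ; _↑ʳ_)
open import Data.Fin.Properties using (_≟_; any?; suc-injective; ↑ʳ-injective)
open import Data.Integer as ℤ using (ℤ; 0ℤ; 1ℤ; -1ℤ; _+_; _-_)
import Data.Integer.Properties as ℤₚ
open import Data.Maybe using (Maybe; just; nothing)
open import Data.Sign using (Sign)
open import Data.List using (List; []; _∷_; _++_; length; replicate)
open import Data.List.Properties using (++-assoc)
open import Data.List.Relation.Unary.Linked as Linked using (Linked; []; [-]; _∷_)
open import Data.List.Relation.Unary.AllPairs using (AllPairs; []; _∷_)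
open import Data.List.Relation.Unary.All as All using (All; []; _∷_)
open import Data.List.Relation.Unary.All.Properties using (¬Any⇒All¬)
import Data.List.Relation.Unary.All.Properties as All
open import Data.List.Relation.Unary.Any using (here; there)
import Data.List.Relation.Unary.Any as Any
open import Data.List.Relation.Unary.Unique.Propositional using (Unique)
open import Data.List.Membership.Propositional using (_∈_)
open import Data.List.Membership.Propositional.Properties using (∈-∃++; ∈-++⁺ˡ; ∈-++⁺ʳ; ∈-++⁻)
open import Data.Vec.Functional using (toList)
open import Data.Product using (∃; ∃₂; _×_; _,_; proj₁; proj₂)
open import Data.Sum as Sum using (_⊎_; inj₁; inj₂; [_,_])
open import Data.Empty using (⊥; ⊥-elim)
open import Data.Unit using (⊤; tt)
open import Function using (_∘_; case_of_)
open import Function.Bundles using (mk⇔; Equivalence)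
open import Relation.Binary.Definitions using (tri<; tri≈; tri>)
open import Relation.Binary.PropositionalEquality
  using (_≡_; _≢_; refl; cong; cong₂; subst; trans; module ≡-Reasoning)
  renaming (sym to ≡-sym)
open import Relation.Nullary using (¬_; Dec; yes; no)
open import Relation.Nullary.Decidable using (_×-dec_; ¬?; decidable-stable)

sumFin-zero : ∀ {k} (f : Fin k → ℤ) → (∀ u → f u ≡ 0ℤ) → sumFin f ≡ 0ℤ
sumFin-zero {zero}  f f≡0 = refl
sumFin-zero {suc k} f f≡0 = cong₂ _+_ (f≡0 zero) (sumFin-zero (f ∘ suc) (f≡0 ∘ suc))

sumFin-point : ∀ {k} (f : Fin k → ℤ) a → (∀ u → u ≢ a → f u ≡ 0ℤ) → sumFin f ≡ f a
sumFin-point f zero f≡0 = begin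
  f zero + sumFin (f ∘ suc) ≡⟨ cong (f zero +_) (sumFin-zero (f ∘ suc) λ u → f≡0 (suc u) λ ()) ⟩
  f zero + 0ℤ               ≡⟨ ℤₚ.+-identityʳ (f zero) ⟩
  f zero                    ∎
  where open ≡-Reasoning
sumFin-point f (suc a) f≡0 = begin
  f zero + sumFin (f ∘ suc) ≡⟨ cong (_+ sumFin (f ∘ suc)) (f≡0 zero λ ()) ⟩
  0ℤ + sumFin (f ∘ suc)     ≡⟨ ℤₚ.+-identityˡ (sumFin (f ∘ suc)) ⟩
  sumFin (f ∘ suc)          ≡⟨ sumFin-point (f ∘ suc) a (λ u u≢a → f≡0 (suc u) (u≢a ∘ suc-injective)) ⟩
  f (suc a)                 ∎
  where open ≡-Reasoning

module _ {A : Set} where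

  last : A → List A → A
  last x []      = x
  last _ (y ∷ l) = last y l

  last-∈ : ∀ x l → last x l ∈ x ∷ l
  last-∈ x []      = here refl
  last-∈ _ (y ∷ l) = there (last-∈ y l)

  last-++ : ∀ x xs {y ys} → last x (xs ++ y ∷ ys) ≡ last y ys
  last-++ x []       = refl
  last-++ _ (x ∷ xs) = last-++ x xs

  length-++-suffix : ∀ xs {y : A} {ys} → length ys ≤ length (xs ++ y ∷ ys)
  length-++-suffix []       = ℕₚ.n≤1+n _
  length-++-suffix (x ∷ xs) = ℕₚ.m≤n⇒m≤1+n (length-++-suffix xs)

  penultimate : A → A → List A → A
  penultimate x _ []      = x
  penultimate _ y (z ∷ l) = penultimate y z l

  penultimate-∷ʳ : ∀ x y l {z} → penultimate x y (l ++ z ∷ []) ≡ last x (y ∷ l)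
  penultimate-∷ʳ x y []      = refl
  penultimate-∷ʳ _ y (z ∷ l) = penultimate-∷ʳ y z l

  Linked-last : ∀ {R : A → A → Set} x y l → Linked R (x ∷ y ∷ l) → R (penultimate x y l) (last y l)
  Linked-last x y []      (r ∷ _) = r
  Linked-last _ y (z ∷ l) (_ ∷ L) = Linked-last y z l L

  NonBacktracking : List A → Set
  NonBacktracking (x ∷ y ∷ z ∷ l) = x ≢ z × NonBacktracking (y ∷ z ∷ l)
  NonBacktracking _               = ⊤

  Unique⇒NonBacktracking : ∀ l → Unique l → NonBacktracking l
  Unique⇒NonBacktracking []              _                     = tt
  Unique⇒NonBacktracking (_ ∷ [])        _                     = tt
  Unique⇒NonBacktracking (_ ∷ _ ∷ [])    _                     = tt
  Unique⇒NonBacktracking (x ∷ y ∷ z ∷ l) ((_ ∷ x≢z ∷ _) ∷ U) = x≢z , Unique⇒NonBacktracking (y ∷ z ∷ l) U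

  Unique-∷ʳ : ∀ l {x : A} → Unique l → All (_≢ x) l → Unique (l ++ x ∷ [])
  Unique-∷ʳ []      _       _          = [] ∷ []
  Unique-∷ʳ (y ∷ l) (y∉ ∷ U) (y≢x ∷ ≢x) = All.++⁺ y∉ (y≢x ∷ []) ∷ Unique-∷ʳ l U ≢x


  ∈-++-insert : ∀ xs {ys} {x z : A} → x ∈ xs ++ ys → x ∈ xs ++ z ∷ ys
  ∈-++-insert xs x∈ = [ ∈-++⁺ˡ , ∈-++⁺ʳ xs ∘ there ] (∈-++⁻ xs x∈)

  module _ {R : A → A → Set} where

    Linked-++⁻ˡ : ∀ xs {ys} → Linked R (xs ++ ys) → Linked R xs
    Linked-++⁻ˡ []           _       = []
    Linked-++⁻ˡ (x ∷ [])     _       = [-]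
    Linked-++⁻ˡ (x ∷ y ∷ xs) (r ∷ L) = r ∷ Linked-++⁻ˡ (y ∷ xs) L

    Linked-++⁻ʳ : ∀ xs {ys} → Linked R (xs ++ ys) → Linked R ys
    Linked-++⁻ʳ []       L = L
    Linked-++⁻ʳ (x ∷ xs) L = Linked-++⁻ʳ xs (Linked.tail L)

    Linked-∷ʳ : ∀ x xs {y} → Linked R (x ∷ xs) → R (last x xs) y → Linked R ((x ∷ xs) ++ y ∷ [])
    Linked-∷ʳ x []       _       r = r ∷ [-]
    Linked-∷ʳ x (z ∷ xs) (r′ ∷ L) r = r′ ∷ Linked-∷ʳ z xs L r

    AllPairs-++⁻ˡ : ∀ xs {ys} → AllPairs R (xs ++ ys) → AllPairs R xs
    AllPairs-++⁻ˡ []       _        = []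
    AllPairs-++⁻ˡ (x ∷ xs) (p ∷ ps) = All.++⁻ˡ xs p ∷ AllPairs-++⁻ˡ xs ps

    AllPairs-++⁻ʳ : ∀ xs {ys} → AllPairs R (xs ++ ys) → AllPairs R ys
    AllPairs-++⁻ʳ []       ps       = ps
    AllPairs-++⁻ʳ (x ∷ xs) (_ ∷ ps) = AllPairs-++⁻ʳ xs ps

IsUnit : ℤ → Set
IsUnit x = x ≡ 1ℤ ⊎ x ≡ -1ℤ

NonUnit : ℤ → Set
NonUnit x = (x ≢ 1ℤ) × (x ≢ -1ℤ)

signVal-±1 : ∀ s → IsUnit (signVal (just s))
signVal-±1 Sign.+ = inj₁ refl
signVal-±1 Sign.- = inj₂ refl

module Graph {k : ℕ} (G : SignedGraph k) where

  Adj-sym : ∀ {u v} → Adj G u v → Adj G v u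
  Adj-sym {u} {v} (s , uv) = s , trans (sym G v u) uv

  Adj-irrefl : ∀ {u} → ¬ Adj G u u
  Adj-irrefl {u} (s , uu) with trans (≡-sym uu) (irrefl G u)
  ... | ()

  Adj⇒≢ : ∀ {u v} → Adj G u v → u ≢ v
  Adj⇒≢ uv refl = Adj-irrefl uv

  Adj? : ∀ u v → Dec (Adj G u v)
  Adj? u v with lab G u v
  ... | just s  = yes (s , refl)
  ... | nothing = no λ ()

  _∷ʳᵂ_ : ∀ {u v w ℓ} → Walk G u v ℓ → Adj G v w → Walk G u w (suc ℓ)
  nil       ∷ʳᵂ vw = cons vw nil
  cons uw W ∷ʳᵂ vw = cons uw (W ∷ʳᵂ vw)

  reverseᵂ : ∀ {u v ℓ} → Walk G u v ℓ → Walk G v u ℓ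
  reverseᵂ nil         = nil
  reverseᵂ (cons uw W) = reverseᵂ W ∷ʳᵂ Adj-sym uw

  _++ᵂ_ : ∀ {u v w a b} → Walk G u v a → Walk G v w b → Walk G u w (a ℕ.+ b)
  nil       ++ᵂ W′ = W′
  cons uw W ++ᵂ W′ = cons uw (W ++ᵂ W′)

  Dist≤ : Fin k → Fin k → ℕ → Set
  Dist≤ u v e = ∃ λ ℓ → ℓ ≤ e × Walk G u v ℓ

  DiamAtMost : ℕ → Set
  DiamAtMost e = ∀ u v → Dist≤ u v e

  Adj⇒Dist≤1 : ∀ {u v} → Adj G u v → Dist≤ u v 1
  Adj⇒Dist≤1 uv = 1 , ℕₚ.≤-refl , cons uv nil

  Dist≤-sym : ∀ {u v e} → Dist≤ u v e → Dist≤ v u e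
  Dist≤-sym (ℓ , ℓ≤e , W) = ℓ , ℓ≤e , reverseᵂ W

  Dist≤-trans : ∀ {u v w a b} → Dist≤ u v a → Dist≤ v w b → Dist≤ u w (a ℕ.+ b)
  Dist≤-trans (ℓ , ℓ≤a , W) (ℓ′ , ℓ′≤b , W′) = ℓ ℕ.+ ℓ′ , ℕₚ.+-mono-≤ ℓ≤a ℓ′≤b , W ++ᵂ W′

  Dist≤-mono : ∀ {u v a b} → a ≤ b → Dist≤ u v a → Dist≤ u v b
  Dist≤-mono a≤b (ℓ , ℓ≤a , W) = ℓ , ℕₚ.≤-trans ℓ≤a a≤b , W

  radius⇒diamAtMost : ∀ {r e} → (∀ v → Dist≤ v r e) → DiamAtMost (e ℕ.+ e)
  radius⇒diamAtMost near-r u v = Dist≤-trans (near-r u) (Dist≤-sym (near-r v))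

  two-centres⇒diamAtMost3 : ∀ {a b} → Adj G a b → (∀ v → Dist≤ v a 1 ⊎ Dist≤ v b 1) → DiamAtMost 3
  two-centres⇒diamAtMost3 {a} {b} ab near u v with near u | near v
  ... | inj₁ ua | inj₁ va = Dist≤-mono (ℕₚ.m≤n+m 2 1) (Dist≤-trans ua (Dist≤-sym va))
  ... | inj₂ ub | inj₂ vb = Dist≤-mono (ℕₚ.m≤n+m 2 1) (Dist≤-trans ub (Dist≤-sym vb))
  ... | inj₁ ua | inj₂ vb = Dist≤-trans (Dist≤-trans ua (Adj⇒Dist≤1 ab)) (Dist≤-sym vb)
  ... | inj₂ ub | inj₁ va = Dist≤-trans (Dist≤-trans ub (Adj⇒Dist≤1 (Adj-sym ab))) (Dist≤-sym va)

  walk? : ∀ ℓ u v → Dec (Walk G u v ℓ)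
  walk? zero u v with u ≟ v
  ... | yes refl = yes nil
  ... | no u≢v   = no λ { nil → u≢v refl }
  walk? (suc ℓ) u v with any? (λ w → Adj? u w ×-dec walk? ℓ w v)
  ... | yes (w , uw , W) = yes (cons uw W)
  ... | no ∄w            = no λ { (cons uw W) → ∄w (_ , uw , W) }

  Dist≤? : ∀ u v e → Dec (Dist≤ u v e)
  Dist≤? u v zero with walk? zero u v
  ... | yes W = yes (0 , z≤n , W)
  ... | no ¬W = no λ { (0 , _ , W) → ¬W W }
  Dist≤? u v (suc e) with Dist≤? u v e | walk? (suc e) u v
  ... | yes d      | _     = yes (Dist≤-mono (ℕₚ.n≤1+n e) d)
  ... | no _       | yes W = yes (suc e , ℕₚ.≤-refl , W)
  ... | no ¬d      | no ¬W = no λ { (ℓ , ℓ≤1+e , W) → case ℕₚ.m≤n⇒m<n∨m≡n ℓ≤1+e of λ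
          { (inj₁ ℓ<1+e) → ¬d (ℓ , ℕₚ.≤-pred ℓ<1+e , W) ; (inj₂ refl) → ¬W W } }

  -- ¬ DiamAtMost d only refutes a universal statement; deciding Dist≤ turns it into an explicit far pair.
  hasDiameter : ∀ d → DiamAtMost (suc d) → ¬ DiamAtMost d → HasDiameter G (suc d)
  hasDiameter d ≤1+d ≰d with any? (λ u → any? (λ v → ¬? (Dist≤? u v d)))
  ... | yes (u , v , ¬d) = ≤1+d , u , v , λ ℓ W → ℕₚ.≰⇒> λ ℓ≤d → ¬d (ℓ , ℓ≤d , W)
  ... | no ∄uv = ⊥-elim (≰d λ u v → decidable-stable (Dist≤? u v d) (λ ¬d → ∄uv (u , v , ¬d)))

  Acyclic : Set
  Acyclic = ¬ HasCycle G

  record Path (x : Fin k) (l : List (Fin k)) (y : Fin k) : Set where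
    constructor path
    field
      linked : Linked (Adj G) (x ∷ l)
      unique : Unique (x ∷ l)
      ends   : last x l ≡ y

  Adj⇒Path : ∀ {x y} → Adj G x y → Path x (y ∷ []) y
  Adj⇒Path xy = path (xy ∷ [-]) ((Adj⇒≢ xy ∷ []) ∷ [] ∷ []) refl

  path⇒walk : ∀ {x l y} → Path x l y → Walk G x y (length l)
  path⇒walk {l = []}    (path _         _ refl) = nil
  path⇒walk {l = b ∷ l} (path (xb ∷ L) (_ ∷ U) e) = cons xb (path⇒walk (path L U e))

  walk⇒path : ∀ {x y ℓ} → Walk G x y ℓ → ∃ λ l → Path x l y × length l ≤ ℓ
  walk⇒path nil = [] , path [-] ([] ∷ []) refl , z≤n
  walk⇒path {x} (cons {w = w} xw W) with walk⇒path W
  ... | q , path L U e , q≤ℓ with Any.any? (x ≟_) (w ∷ q)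
  ...   | no x∉  = w ∷ q , path (xw ∷ L) (¬Any⇒All¬ _ x∉ ∷ U) e , s≤s q≤ℓ
  ...   | yes (here refl) = ⊥-elim (Adj-irrefl xw)
  ...   | yes (there x∈q) with ∈-∃++ x∈q
  ...     | q₁ , q₂ , refl =
    q₂ , path (Linked-++⁻ʳ (w ∷ q₁) L) (AllPairs-++⁻ʳ (w ∷ q₁) U) (trans (≡-sym (last-++ w q₁)) e) ,
    ℕₚ.≤-trans (length-++-suffix q₁) (ℕₚ.m≤n⇒m≤1+n q≤ℓ)

  chord⇒cycle : ∀ {x b q w} → Unique (x ∷ b ∷ q) → Linked (Adj G) (x ∷ b ∷ q) → w ∈ q → Adj G w x →
                HasCycle G
  chord⇒cycle {x} {b} {q} {w} U L w∈q wx with ∈-∃++ w∈q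
  ... | q₁ , q₂ , refl = close q₁
    (AllPairs-++⁻ˡ (x ∷ b ∷ q₁ ++ w ∷ []) (subst Unique rebracket U))
    (Linked-∷ʳ x (b ∷ q₁ ++ w ∷ [])
      (Linked-++⁻ˡ (x ∷ b ∷ q₁ ++ w ∷ []) (subst (Linked (Adj G)) rebracket L))
      (subst (λ t → Adj G t x) (≡-sym (last-++ b q₁)) wx))
    where
    rebracket : x ∷ b ∷ q₁ ++ w ∷ q₂ ≡ (x ∷ b ∷ q₁ ++ w ∷ []) ++ q₂
    rebracket = cong (λ t → x ∷ b ∷ t) (≡-sym (++-assoc q₁ (w ∷ []) q₂))
    close : ∀ q₁ → Unique (x ∷ b ∷ q₁ ++ w ∷ []) → Linked (Adj G) ((x ∷ b ∷ q₁ ++ w ∷ []) ++ x ∷ []) →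
            HasCycle G
    close []        U L = x , b , w , [] , U , L
    close (c ∷ q₁′) U L = x , b , c , q₁′ ++ w ∷ [] , U , L

  path-∷ : Acyclic → ∀ {a x b l y} → Path x (b ∷ l) y → Adj G a x → a ≢ b → Path a (x ∷ b ∷ l) y
  path-∷ ac {a} {l = l} (path L U e) ax a≢b with Any.any? (a ≟_) l
  ... | yes a∈l = ⊥-elim (ac (chord⇒cycle U L a∈l ax))
  ... | no a∉l  = path (ax ∷ L) ((Adj⇒≢ ax ∷ a≢b ∷ ¬Any⇒All¬ l a∉l) ∷ U) e

  -- Induction on the walk: if its first step leaves the path, prepending that step gives a longer
  -- path (a step back onto the path would close a cycle).
  path-length≤walk : Acyclic → ∀ {x l y ℓ} → Path x l y → Walk G x y ℓ → length l ≤ ℓ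
  path-length≤walk ac {l = []} _ _ = z≤n
  path-length≤walk ac {l = b ∷ l} (path _ (x∉ ∷ _) e) nil = ⊥-elim (All.lookup x∉ (last-∈ b l) (≡-sym e))
  path-length≤walk ac {x} {b ∷ l} (path L U e) (cons {w = w} xw W) with w ≟ b
  ... | yes refl = s≤s (path-length≤walk ac (path (Linked.tail L) (AllPairs-++⁻ʳ (x ∷ []) U) e) W)
  ... | no w≢b with Any.any? (w ≟_) (x ∷ b ∷ l)
  ...   | no w∉ = ℕₚ.m≤n⇒m≤1+n (ℕₚ.≤-trans (ℕₚ.n≤1+n _)
                    (path-length≤walk ac (path (Adj-sym xw ∷ L) (¬Any⇒All¬ _ w∉ ∷ U) e) W))
  ...   | yes (here refl)         = ⊥-elim (Adj-irrefl xw)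
  ...   | yes (there (here refl)) = ⊥-elim (w≢b refl)
  ...   | yes (there (there w∈l)) = ⊥-elim (ac (chord⇒cycle U L w∈l (Adj-sym xw)))

  path-reverse : Acyclic → ∀ {x l y} → Path x l y → ∃ λ l′ → Path y l′ x × length l ≤ length l′
  path-reverse ac P with walk⇒path (reverseᵂ (path⇒walk P))
  ... | l′ , P′ , _ = l′ , P′ , path-length≤walk ac P (reverseᵂ (path⇒walk P′))

  Branching : Fin k → Set
  Branching c = ∃₂ λ a b → a ≢ b × Adj G c a × Adj G c b

  neighbour-≢ : ∀ {c} → Branching c → ∀ b → ∃ λ a → Adj G c a × a ≢ b
  neighbour-≢ (a , a′ , a≢a′ , ca , ca′) b with a ≟ b
  ... | yes refl = a′ , ca′ , a≢a′ ∘ ≡-sym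
  ... | no a≢b   = a , ca , a≢b

  sdeg-one-neighbour : ∀ {c a} → (∀ u → u ≢ a → ¬ Adj G c u) → sdeg G c ≡ signVal (lab G c a)
  sdeg-one-neighbour {c} {a} only = sumFin-point (λ u → signVal (lab G c u)) a no-edge
    where
    no-edge : ∀ u → u ≢ a → signVal (lab G c u) ≡ 0ℤ
    no-edge u u≢a with lab G c u in cu
    ... | nothing = refl
    ... | just s  = ⊥-elim (only u u≢a (s , cu))

  sdeg≢±1⇒branching : Connected G → ∀ {c w} → w ≢ c → sdeg G c ≢ 1ℤ → sdeg G c ≢ -1ℤ → Branching c
  sdeg≢±1⇒branching conn {c} {w} w≢c ≢1 ≢-1 with conn c w
  ... | _ , nil = ⊥-elim (w≢c refl)
  ... | _ , cons {w = a} ca@(s , cas) _ with any? (λ b → ¬? (b ≟ a) ×-dec Adj? c b)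
  ...   | yes (b , b≢a , cb) = a , b , b≢a ∘ ≡-sym , ca , cb
  ...   | no ∄b with signVal-±1 s
                    | trans (sdeg-one-neighbour (λ u u≢a cu → ∄b (u , u≢a , cu))) (cong signVal cas)
  ...     | inj₁ ≡1  | deg = ⊥-elim (≢1 (trans deg ≡1))
  ...     | inj₂ ≡-1 | deg = ⊥-elim (≢-1 (trans deg ≡-1))

  module _ (ac : Acyclic) {e} (diam≤e : DiamAtMost e) where

    branching⇒2≤diam : ∀ {c} → Branching c → 2 ≤ e
    branching⇒2≤diam (a , b , a≢b , ca , cb) with diam≤e a b
    ... | ℓ , ℓ≤e , W = ℕₚ.≤-trans (path-length≤walk ac (path-∷ ac (Adj⇒Path cb) (Adj-sym ca) a≢b) W) ℓ≤e

    -- Extending a path between c₁ and c₂ at both ends by a further neighbour keeps it a path.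
    branching-pair : ∀ {c₁ c₂} → c₁ ≢ c₂ → Branching c₁ → Branching c₂ →
                     ∃₂ λ b l → Path c₁ (b ∷ l) c₂ × 3 ℕ.+ length l ≤ e
    branching-pair {c₁} {c₂} c₁≢c₂ br₁ br₂ with walk⇒path (proj₂ (proj₂ (diam≤e c₁ c₂)))
    ... | [] , path _ _ refl , _ = ⊥-elim (c₁≢c₂ refl)
    ... | b ∷ l , P , _ with neighbour-≢ br₁ b
    ... | x₁ , c₁x₁ , x₁≢b with path-reverse ac (path-∷ ac P (Adj-sym c₁x₁) x₁≢b)
    ... | [] , _ , ()
    ... | b₂ ∷ l₂ , P₂ , 2+l≤l₂ with neighbour-≢ br₂ b₂
    ... | x₂ , c₂x₂ , x₂≢b₂ with diam≤e x₂ x₁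
    ... | ℓ , ℓ≤e , W = b , l , P ,
      ℕₚ.≤-trans (s≤s 2+l≤l₂) (ℕₚ.≤-trans (path-length≤walk ac (path-∷ ac P₂ (Adj-sym c₂x₂) x₂≢b₂) W) ℓ≤e)

    two-branching⇒3≤diam : ∀ {c₁ c₂} → c₁ ≢ c₂ → Branching c₁ → Branching c₂ → 3 ≤ e
    two-branching⇒3≤diam c₁≢c₂ br₁ br₂ with branching-pair c₁≢c₂ br₁ br₂
    ... | _ , l , _ , 3+l≤e = ℕₚ.≤-trans (ℕₚ.m≤m+n 3 (length l)) 3+l≤e

    diam≤3⇒adjacent : e ≤ 3 → ∀ {c₁ c₂} → c₁ ≢ c₂ → Branching c₁ → Branching c₂ → Adj G c₁ c₂
    diam≤3⇒adjacent e≤3 c₁≢c₂ br₁ br₂ with branching-pair c₁≢c₂ br₁ br₂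
    ... | _ , []    , path (c₁c₂ ∷ _) _ refl , _ = c₁c₂
    ... | _ , _ ∷ l , _ , 4+l≤e =
      ⊥-elim (ℕₚ.<-irrefl refl (ℕₚ.≤-trans (ℕₚ.m≤m+n 4 (length l)) (ℕₚ.≤-trans 4+l≤e e≤3)))

    three-branching⇒4≤diam : ∀ {c₁ c₂ c₃} → c₁ ≢ c₂ → c₁ ≢ c₃ → c₂ ≢ c₃ →
                             Branching c₁ → Branching c₂ → Branching c₃ → 4 ≤ e
    three-branching⇒4≤diam {c₁} {c₂} {c₃} c₁≢c₂ c₁≢c₃ c₂≢c₃ br₁ br₂ br₃ with e ≤? 3
    ... | no e≰3  = ℕₚ.≰⇒> e≰3
    ... | yes e≤3 = ⊥-elim (ac (c₁ , c₂ , c₃ , [] ,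
                      ((c₁≢c₂ ∷ c₁≢c₃ ∷ []) ∷ (c₂≢c₃ ∷ []) ∷ [] ∷ []) ,
                      adj c₁≢c₂ br₁ br₂ ∷ adj c₂≢c₃ br₂ br₃ ∷ Adj-sym (adj c₁≢c₃ br₁ br₃) ∷ [-]))
      where adj = diam≤3⇒adjacent e≤3

module LowerBound {k} {G : SignedGraph k} {D : List ℤ}
                  (tree : IsTree G) (realizes : Realizes G D) (1∈D : 1ℤ ∈ D) where
  open Graph G

  private
    acyclic : Acyclic
    acyclic = proj₂ (proj₂ tree)

  branching-realizer : ∀ {x} → x ∈ D → NonUnit x → ∃ λ c → sdeg G c ≡ x × Branching c
  branching-realizer x∈D (x≢1 , x≢-1) with Equivalence.to (realizes _) x∈D | Equivalence.to (realizes _) 1∈D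
  ... | c , c↦x | w , w↦1 = c , c↦x ,
    sdeg≢±1⇒branching (proj₁ (proj₂ tree)) w≢c (x≢1 ∘ trans (≡-sym c↦x)) (x≢-1 ∘ trans (≡-sym c↦x))
    where
    w≢c : w ≢ c
    w≢c refl = x≢1 (trans (≡-sym c↦x) w↦1)

  private
    realizers-≢ : ∀ {c c′ x x′} → sdeg G c ≡ x → sdeg G c′ ≡ x′ → x ≢ x′ → c ≢ c′
    realizers-≢ c↦x c′↦x′ x≢x′ refl = x≢x′ (trans (≡-sym c↦x) c′↦x′)

  2≤diam : ∀ {x e} → x ∈ D → NonUnit x → DiamAtMost e → 2 ≤ e
  2≤diam x∈D nu diam≤e with branching-realizer x∈D nu
  ... | _ , _ , br = branching⇒2≤diam acyclic diam≤e br

  3≤diam : ∀ {x₁ x₂ e} → x₁ ∈ D → x₂ ∈ D → x₁ ≢ x₂ → NonUnit x₁ → NonUnit x₂ → DiamAtMost e → 3 ≤ e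
  3≤diam x₁∈D x₂∈D x₁≢x₂ nu₁ nu₂ diam≤e
    with branching-realizer x₁∈D nu₁ | branching-realizer x₂∈D nu₂
  ... | _ , c₁↦x₁ , br₁ | _ , c₂↦x₂ , br₂ =
    two-branching⇒3≤diam acyclic diam≤e (realizers-≢ c₁↦x₁ c₂↦x₂ x₁≢x₂) br₁ br₂

  4≤diam : ∀ {x₁ x₂ x₃ e} → x₁ ∈ D → x₂ ∈ D → x₃ ∈ D → x₁ ≢ x₂ → x₁ ≢ x₃ → x₂ ≢ x₃ →
           NonUnit x₁ → NonUnit x₂ → NonUnit x₃ → DiamAtMost e → 4 ≤ e
  4≤diam x₁∈D x₂∈D x₃∈D x₁≢x₂ x₁≢x₃ x₂≢x₃ nu₁ nu₂ nu₃ diam≤e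
    with branching-realizer x₁∈D nu₁ | branching-realizer x₂∈D nu₂ | branching-realizer x₃∈D nu₃
  ... | _ , c₁↦x₁ , br₁ | _ , c₂↦x₂ , br₂ | _ , c₃↦x₃ , br₃ =
    three-branching⇒4≤diam acyclic diam≤e (realizers-≢ c₁↦x₁ c₂↦x₂ x₁≢x₂)
      (realizers-≢ c₁↦x₁ c₃↦x₃ x₁≢x₃) (realizers-≢ c₂↦x₂ c₃↦x₃ x₂≢x₃) br₁ br₂ br₃

-- Acyclicity from a rank function

module _ {k} (G : SignedGraph k) (r : Fin k → ℕ) where
  open Graph G

  ParentRanked : Set
  ParentRanked = (∀ u v → Adj G u v → r u ≢ r v) ×
                 (∀ v a b → Adj G v a → Adj G v b → r a < r v → r b < r v → a ≡ b)

  module _ (ranked : ParentRanked) where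

    private
      r-≢ : ∀ u v → Adj G u v → r u ≢ r v
      r-≢ = proj₁ ranked

      parent-unique : ∀ v a b → Adj G v a → Adj G v b → r a < r v → r b < r v → a ≡ b
      parent-unique = proj₂ ranked

      compare-adj : ∀ {u v} → Adj G u v → r u < r v ⊎ r v < r u
      compare-adj {u} {v} uv with ℕₚ.<-cmp (r u) (r v)
      ... | tri< u<v _ _ = inj₁ u<v
      ... | tri≈ _ u≡v _ = ⊥-elim (r-≢ u v uv u≡v)
      ... | tri> _ _ v<u = inj₂ v<u

      -- After a step up, a step down would return to the unique parent, i.e. backtrack.
      ascent-persists : ∀ x y l → Linked (Adj G) (x ∷ y ∷ l) → NonBacktracking (x ∷ y ∷ l) → r x < r y →
                        r x < r (last y l) × r (penultimate x y l) < r (last y l)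
      ascent-persists x y []      _               _           x<y = x<y , x<y
      ascent-persists x y (z ∷ l) (xy ∷ yz ∷ L) (x≢z , nb) x<y with compare-adj yz
      ... | inj₂ z<y = ⊥-elim (x≢z (parent-unique y x z (Adj-sym xy) yz x<y z<y))
      ... | inj₁ y<z with ascent-persists y z l (yz ∷ L) nb y<z
      ...   | y<last , final = ℕₚ.<-trans x<y y<last , final

      descent-or-final-ascent : ∀ x y l → Linked (Adj G) (x ∷ y ∷ l) → NonBacktracking (x ∷ y ∷ l) →
                                r y < r x → r (last y l) < r x ⊎ r (penultimate x y l) < r (last y l)
      descent-or-final-ascent x y []      _             _          y<x = inj₁ y<x
      descent-or-final-ascent x y (z ∷ l) (_ ∷ yz ∷ L) (_ , nb) y<x with compare-adj yz
      ... | inj₁ y<z = inj₂ (proj₂ (ascent-persists y z l (yz ∷ L) nb y<z))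
      ... | inj₂ z<y with descent-or-final-ascent y z l (yz ∷ L) nb z<y
      ...   | inj₁ last<y = inj₁ (ℕₚ.<-trans last<y y<x)
      ...   | inj₂ final  = inj₂ final

      -- Once it climbs, the walk keeps climbing, so a closed one must leave x downwards and return to x
      -- upwards: y and the penultimate vertex are then two lower neighbours of x.
      closed-walk : ∀ x y l → Linked (Adj G) (x ∷ y ∷ l) → NonBacktracking (x ∷ y ∷ l) →
                    last y l ≡ x → penultimate x y l ≢ y → ⊥
      closed-walk x y l L@(xy ∷ _) nb refl pen≢y with compare-adj xy
      ... | inj₁ x<y = ℕₚ.<-irrefl refl (proj₁ (ascent-persists x y l L nb x<y))
      ... | inj₂ y<x with descent-or-final-ascent x y l L nb y<x
      ...   | inj₁ x<x  = ℕₚ.<-irrefl refl x<x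
      ...   | inj₂ pen<x = pen≢y (parent-unique x _ y (Adj-sym (Linked-last x y l L)) xy pen<x y<x)

    parentRanked⇒acyclic : Acyclic
    parentRanked⇒acyclic (x , y , z , rest , (x∉@(_ ∷ x≢z ∷ _) ∷ Uy@(y∉ ∷ _)) , L) =
      closed-walk x y (z ∷ rest ++ x ∷ []) L nb (last-++ z rest) pen≢y
      where
      nb : NonBacktracking (x ∷ y ∷ z ∷ rest ++ x ∷ [])
      nb = x≢z , Unique⇒NonBacktracking (y ∷ z ∷ rest ++ x ∷ [])
                   (Unique-∷ʳ (y ∷ z ∷ rest) Uy (All.map (_∘ ≡-sym) x∉))
      pen≢y : penultimate x y (z ∷ rest ++ x ∷ []) ≢ y
      pen≢y pen≡y =
        All.lookup y∉ (last-∈ z rest) (≡-sym (trans (≡-sym (penultimate-∷ʳ x y (z ∷ rest))) pen≡y))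

-- Trees grown by attaching leaves

-- A new vertex is always added as vertex 0 of Fin (suc k), and the old vertex u becomes suc u: with this
-- rank the new vertex is the highest one and every old vertex keeps its rank.
rank : ∀ {k} → Fin k → ℕ
rank {k} v = k ℕ.∸ suc (toℕ v)

rank<size : ∀ {k} (v : Fin k) → rank v < k
rank<size {suc k} zero    = ℕₚ.n<1+n k
rank<size {suc k} (suc v) = ℕₚ.m<n⇒m<1+n (rank<size v)

RankedTree : ∀ {k} → SignedGraph k → Set
RankedTree G = Connected G × ParentRanked G rank

rankedTree⇒isTree : ∀ {k} (G : SignedGraph k) → RankedTree G → Fin k → IsTree G
rankedTree⇒isTree G (conn , ranked) v =
  ℕₚ.≤-trans (s≤s z≤n) (rank<size v) , conn , parentRanked⇒acyclic G rank ranked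

point : SignedGraph 1
point = record { lab = λ _ _ → nothing ; sym = λ _ _ → refl ; irrefl = λ _ → refl }

point-rankedTree : RankedTree point
point-rankedTree = (λ { zero zero → 0 , nil }) , (λ _ _ ()) , λ _ _ _ ()

module AddLeaf {k} (G : SignedGraph k) (p : Fin k) (s : Sign) where

  toParent : Fin k → Maybe Sign
  toParent v with v ≟ p
  ... | yes _ = just s
  ... | no _  = nothing

  toParent-p : toParent p ≡ just s
  toParent-p with p ≟ p
  ... | yes _  = refl
  ... | no p≢p = ⊥-elim (p≢p refl)

  toParent-≢ : ∀ {v} → v ≢ p → toParent v ≡ nothing
  toParent-≢ {v} v≢p with v ≟ p
  ... | yes v≡p = ⊥-elim (v≢p v≡p)
  ... | no _    = refl

  toParent-just : ∀ {v t} → toParent v ≡ just t → v ≡ p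
  toParent-just {v} _  with v ≟ p
  toParent-just     _  | yes v≡p = v≡p
  toParent-just     () | no _

  graph : SignedGraph (suc k)
  graph = record { lab = lab′ ; sym = sym′ ; irrefl = irrefl′ }
    where
    lab′ : Fin (suc k) → Fin (suc k) → Maybe Sign
    lab′ zero    zero    = nothing
    lab′ zero    (suc v) = toParent v
    lab′ (suc u) zero    = toParent u
    lab′ (suc u) (suc v) = lab G u v
    sym′ : ∀ u v → lab′ u v ≡ lab′ v u
    sym′ zero    zero    = refl
    sym′ zero    (suc v) = refl
    sym′ (suc u) zero    = refl
    sym′ (suc u) (suc v) = sym G u v
    irrefl′ : ∀ v → lab′ v v ≡ nothing
    irrefl′ zero    = refl
    irrefl′ (suc v) = irrefl G v

  leaf-adj : Adj graph zero (suc p)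
  leaf-adj = s , toParent-p

  sdeg-leaf : sdeg graph zero ≡ signVal (just s)
  sdeg-leaf = begin
    0ℤ + sumFin (λ v → signVal (toParent v)) ≡⟨ ℤₚ.+-identityˡ _ ⟩
    sumFin (λ v → signVal (toParent v))      ≡⟨ sumFin-point _ p (λ _ v≢p → cong signVal (toParent-≢ v≢p)) ⟩
    signVal (toParent p)                     ≡⟨ cong signVal toParent-p ⟩
    signVal (just s)                         ∎
    where open ≡-Reasoning

  sdeg-parent : sdeg graph (suc p) ≡ signVal (just s) + sdeg G p
  sdeg-parent = cong (λ t → signVal t + sdeg G p) toParent-p

  sdeg-old : ∀ {u} → u ≢ p → sdeg graph (suc u) ≡ sdeg G u
  sdeg-old {u} u≢p = trans (cong (λ t → signVal t + sdeg G u) (toParent-≢ u≢p)) (ℤₚ.+-identityˡ (sdeg G u))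

  liftᵂ : ∀ {u v ℓ} → Walk G u v ℓ → Walk graph (suc u) (suc v) ℓ
  liftᵂ nil         = nil
  liftᵂ (cons uw W) = cons uw (liftᵂ W)

  connected : Connected G → Connected graph
  connected conn zero    zero    = 0 , nil
  connected conn zero    (suc v) = _ , cons leaf-adj (liftᵂ (proj₂ (conn p v)))
  connected conn (suc u) zero    =
    _ , Graph._∷ʳᵂ_ graph (liftᵂ (proj₂ (conn u p))) (Graph.Adj-sym graph {zero} {suc p} leaf-adj)
  connected conn (suc u) (suc v) = _ , liftᵂ (proj₂ (conn u v))

  parentRanked : ParentRanked G rank → ParentRanked graph rank
  parentRanked (rank-≢ , parent-unique) = rank-≢′ , parent-unique′
    where
    rank-≢′ : ∀ u v → Adj graph u v → rank u ≢ rank v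
    rank-≢′ zero    zero    (_ , ())
    rank-≢′ zero    (suc v) _  ≡rank = ℕₚ.<-irrefl (≡-sym ≡rank) (rank<size v)
    rank-≢′ (suc u) zero    _  ≡rank = ℕₚ.<-irrefl ≡rank (rank<size u)
    rank-≢′ (suc u) (suc v) uv = rank-≢ u v uv
    parent-unique′ : ∀ v a b → Adj graph v a → Adj graph v b → rank a < rank v → rank b < rank v → a ≡ b
    parent-unique′ zero    zero    _       (_ , ()) _
    parent-unique′ zero    _       zero    _        (_ , ())
    parent-unique′ zero    (suc a) (suc b) (_ , va) (_ , vb) _ _ =
      cong suc (trans (toParent-just va) (≡-sym (toParent-just vb)))
    parent-unique′ (suc v) zero    _       _        _        a<v _ = ⊥-elim (ℕₚ.<-asym a<v (rank<size v))
    parent-unique′ (suc v) (suc a) zero    _        _        _ b<v = ⊥-elim (ℕₚ.<-asym b<v (rank<size v))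
    parent-unique′ (suc v) (suc a) (suc b) va       vb       a<v b<v =
      cong suc (parent-unique v a b va vb a<v b<v)

  rankedTree : RankedTree G → RankedTree graph
  rankedTree (conn , ranked) = connected conn , parentRanked ranked

addLeaf : ∀ {k} → SignedGraph k → Fin k → Sign → SignedGraph (suc k)
addLeaf = AddLeaf.graph

addLeaves : ∀ {k} → SignedGraph k → Fin k → (ss : List Sign) → SignedGraph (length ss ℕ.+ k)
addLeaves G p []       = G
addLeaves G p (s ∷ ss) = addLeaf (addLeaves G p ss) (length ss ↑ʳ p) s

signSum : List Sign → ℤ
signSum []       = 0ℤ
signSum (s ∷ ss) = signVal (just s) + signSum ss

module AddLeaves {k} (G : SignedGraph k) (p : Fin k) where

  old : (ss : List Sign) → Fin k → Fin (length ss ℕ.+ k)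
  old ss = length ss ↑ʳ_

  private
    module Step (ss : List Sign) (s : Sign) = AddLeaf (addLeaves G p ss) (old ss p) s

  rankedTree : ∀ ss → RankedTree G → RankedTree (addLeaves G p ss)
  rankedTree []       t = t
  rankedTree (s ∷ ss) t = Step.rankedTree ss s (rankedTree ss t)

  old-injective : ∀ ss {u v} → old ss u ≡ old ss v → u ≡ v
  old-injective ss {u} {v} = ↑ʳ-injective (length ss) u v

  lift-Adj : ∀ ss {u v} → Adj G u v → Adj (addLeaves G p ss) (old ss u) (old ss v)
  lift-Adj []       uv = uv
  lift-Adj (s ∷ ss) uv = lift-Adj ss uv

  liftᵂ : ∀ ss {u v ℓ} → Walk G u v ℓ → Walk (addLeaves G p ss) (old ss u) (old ss v) ℓ
  liftᵂ ss nil         = nil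
  liftᵂ ss (cons uw W) = cons (lift-Adj ss uw) (liftᵂ ss W)

  lift-Dist≤ : ∀ ss {u v e} → Graph.Dist≤ G u v e → Graph.Dist≤ (addLeaves G p ss) (old ss u) (old ss v) e
  lift-Dist≤ ss (ℓ , ℓ≤e , W) = ℓ , ℓ≤e , liftᵂ ss W

  sdeg-old : ∀ ss {u} → u ≢ p → sdeg (addLeaves G p ss) (old ss u) ≡ sdeg G u
  sdeg-old []       u≢p = refl
  sdeg-old (s ∷ ss) {u} u≢p =
    trans (Step.sdeg-old ss s (u≢p ∘ old-injective ss)) (sdeg-old ss u≢p)

  sdeg-parent : ∀ ss → sdeg (addLeaves G p ss) (old ss p) ≡ signSum ss + sdeg G p
  sdeg-parent [] = ≡-sym (ℤₚ.+-identityˡ (sdeg G p))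
  sdeg-parent (s ∷ ss) = begin
    sdeg (addLeaves G p (s ∷ ss)) (old (s ∷ ss) p)        ≡⟨ Step.sdeg-parent ss s ⟩
    signVal (just s) + sdeg (addLeaves G p ss) (old ss p) ≡⟨ cong (signVal (just s) +_) (sdeg-parent ss) ⟩
    signVal (just s) + (signSum ss + sdeg G p)            ≡⟨ ℤₚ.+-assoc (signVal (just s)) (signSum ss) _ ⟨
    signSum (s ∷ ss) + sdeg G p                           ∎
    where open ≡-Reasoning

  old-or-leaf : ∀ ss (v : Fin (length ss ℕ.+ k)) →
                (∃ λ u → v ≡ old ss u) ⊎
                (Adj (addLeaves G p ss) v (old ss p) × IsUnit (sdeg (addLeaves G p ss) v))
  old-or-leaf []       v       = inj₁ (v , refl)
  old-or-leaf (s ∷ ss) zero    =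
    inj₂ (Step.leaf-adj ss s , subst IsUnit (≡-sym (Step.sdeg-leaf ss s)) (signVal-±1 s))
  old-or-leaf (s ∷ ss) (suc v) with old-or-leaf ss v
  ... | inj₁ (u , refl) = inj₁ (u , refl)
  ... | inj₂ (vp , unit) =
    inj₂ (vp , subst IsUnit (≡-sym (Step.sdeg-old ss s (Graph.Adj⇒≢ (addLeaves G p ss) vp))) unit)

  leaf-of-sign : ∀ ss {s} → s ∈ ss →
                 ∃ λ v → Adj (addLeaves G p ss) v (old ss p) × sdeg (addLeaves G p ss) v ≡ signVal (just s)
  leaf-of-sign (s ∷ ss) (here refl) = zero , Step.leaf-adj ss s , Step.sdeg-leaf ss s
  leaf-of-sign (s ∷ ss) (there s∈ss) with leaf-of-sign ss s∈ss
  ... | v , vp , v↦s = suc v , vp , trans (Step.sdeg-old ss s (Graph.Adj⇒≢ (addLeaves G p ss) vp)) v↦s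

balancingSigns : ℤ → List Sign
balancingSigns (ℤ.+ n)    = replicate n Sign.+
balancingSigns ℤ.-[1+ n ] = replicate (suc n) Sign.-

signSum-balancingSigns : ∀ x → signSum (balancingSigns x) ≡ x
signSum-balancingSigns (ℤ.+ zero)     = refl
signSum-balancingSigns (ℤ.+ suc n)    = cong (1ℤ +_) (signSum-balancingSigns (ℤ.+ n))
signSum-balancingSigns ℤ.-[1+ zero ]  = refl
signSum-balancingSigns ℤ.-[1+ suc n ] = cong (-1ℤ +_) (signSum-balancingSigns ℤ.-[1+ n ])

-- Both signs are always present, so that leaves of signed degree 1 and -1 always occur.
leafSigns : ℤ → List Sign
leafSigns x = Sign.+ ∷ Sign.- ∷ balancingSigns x

signSum-leafSigns : ∀ x → signSum (leafSigns x) ≡ x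
signSum-leafSigns x =
  trans (≡-sym (ℤₚ.+-assoc 1ℤ -1ℤ (signSum (balancingSigns x))))
        (trans (ℤₚ.+-identityˡ _) (signSum-balancingSigns x))

minus-+ : ∀ x y → (x - y) + y ≡ x
minus-+ x y = begin
  (x - y) + y   ≡⟨ ℤₚ.+-assoc x (ℤ.- y) y ⟩
  x + (ℤ.- y + y) ≡⟨ cong (x +_) (ℤₚ.+-inverseˡ y) ⟩
  x + 0ℤ        ≡⟨ ℤₚ.+-identityʳ x ⟩
  x             ∎
  where open ≡-Reasoning

module SetDegree {k} (G : SignedGraph k) (p : Fin k) (d x : ℤ) where
  open AddLeaves G p public

  graph : SignedGraph (length (leafSigns (x - d)) ℕ.+ k)
  graph = addLeaves G p (leafSigns (x - d))

  sdeg-target : sdeg G p ≡ d → sdeg graph (old (leafSigns (x - d)) p) ≡ x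
  sdeg-target p↦d = begin
    sdeg graph (old (leafSigns (x - d)) p)   ≡⟨ sdeg-parent (leafSigns (x - d)) ⟩
    signSum (leafSigns (x - d)) + sdeg G p   ≡⟨ cong₂ _+_ (signSum-leafSigns (x - d)) p↦d ⟩
    (x - d) + d                              ≡⟨ minus-+ x d ⟩
    x                                        ∎
    where open ≡-Reasoning

-- hubTree ws: a root joined by positive edges to one hub per w ∈ ws, the hub of w carrying leaves
-- that raise its signed degree from 1 to w.
hubTreeSize : List ℤ → ℕ
hubTreeSize []       = 1
hubTreeSize (w ∷ ws) = length (leafSigns (w - 1ℤ)) ℕ.+ suc (hubTreeSize ws)

hubRoot : ∀ ws → Fin (hubTreeSize ws)
hubRoot []       = zero
hubRoot (w ∷ ws) = length (leafSigns (w - 1ℤ)) ↑ʳ suc (hubRoot ws)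

hubTree : ∀ ws → SignedGraph (hubTreeSize ws)
hubTree []       = point
hubTree (w ∷ ws) = SetDegree.graph (addLeaf (hubTree ws) (hubRoot ws) Sign.+) zero 1ℤ w

module HubStep (w : ℤ) (ws : List ℤ) where
  private
    module Hub = AddLeaf (hubTree ws) (hubRoot ws) Sign.+
    signs : List Sign
    signs = leafSigns (w - 1ℤ)
    open SetDegree Hub.graph zero 1ℤ w
      using (old; old-injective; old-or-leaf; lift-Adj; liftᵂ; sdeg-old; sdeg-target)

  embed : Fin (suc (hubTreeSize ws)) → Fin (hubTreeSize (w ∷ ws))
  embed = old signs

  hub : Fin (hubTreeSize (w ∷ ws))
  hub = embed zero

  embed-injective : ∀ {u v} → embed u ≡ embed v → u ≡ v
  embed-injective = old-injective signs

  embed-or-leaf : ∀ v → (∃ λ u → v ≡ embed u) ⊎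
                        (Adj (hubTree (w ∷ ws)) v hub × IsUnit (sdeg (hubTree (w ∷ ws)) v))
  embed-or-leaf = old-or-leaf signs

  rankedTree : RankedTree (hubTree ws) → RankedTree (hubTree (w ∷ ws))
  rankedTree = SetDegree.rankedTree Hub.graph zero 1ℤ w signs ∘ Hub.rankedTree

  sdeg-hub : sdeg (hubTree (w ∷ ws)) hub ≡ w
  sdeg-hub = sdeg-target Hub.sdeg-leaf

  sdeg-root : sdeg (hubTree (w ∷ ws)) (hubRoot (w ∷ ws)) ≡ 1ℤ + sdeg (hubTree ws) (hubRoot ws)
  sdeg-root = trans (sdeg-old signs λ ()) Hub.sdeg-parent

  sdeg-embed : ∀ {u} → u ≢ hubRoot ws → sdeg (hubTree (w ∷ ws)) (embed (suc u)) ≡ sdeg (hubTree ws) u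
  sdeg-embed u≢r = trans (sdeg-old signs λ ()) (Hub.sdeg-old u≢r)

  hub-adj-root : Adj (hubTree (w ∷ ws)) hub (hubRoot (w ∷ ws))
  hub-adj-root = lift-Adj signs Hub.leaf-adj

  lift-Dist≤ : ∀ {u v e} → Graph.Dist≤ (hubTree ws) u v e →
               Graph.Dist≤ (hubTree (w ∷ ws)) (embed (suc u)) (embed (suc v)) e
  lift-Dist≤ (ℓ , ℓ≤e , W) = ℓ , ℓ≤e , liftᵂ signs (Hub.liftᵂ W)

  open Graph (hubTree (w ∷ ws)) using (Dist≤; Dist≤-trans; Dist≤-mono; Adj⇒Dist≤1)

  radius2 : (∀ u → Graph.Dist≤ (hubTree ws) u (hubRoot ws) 2) → ∀ v → Dist≤ v (hubRoot (w ∷ ws)) 2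
  radius2 near v with embed-or-leaf v
  ... | inj₂ (v-hub , _)   = Dist≤-trans (Adj⇒Dist≤1 v-hub) (Adj⇒Dist≤1 hub-adj-root)
  ... | inj₁ (zero , refl)  = Dist≤-mono (ℕₚ.n≤1+n 1) (Adj⇒Dist≤1 hub-adj-root)
  ... | inj₁ (suc u , refl) = lift-Dist≤ (near u)

hubTree-rankedTree : ∀ ws → RankedTree (hubTree ws)
hubTree-rankedTree []       = point-rankedTree
hubTree-rankedTree (w ∷ ws) = HubStep.rankedTree w ws (hubTree-rankedTree ws)

sdeg-hubRoot : ∀ ws → sdeg (hubTree ws) (hubRoot ws) ≡ ℤ.+ length ws
sdeg-hubRoot []       = refl
sdeg-hubRoot (w ∷ ws) = trans (HubStep.sdeg-root w ws) (cong (1ℤ +_) (sdeg-hubRoot ws))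

hubTree-sdeg∈ : ∀ ws v → v ≢ hubRoot ws → sdeg (hubTree ws) v ∈ 1ℤ ∷ -1ℤ ∷ ws
hubTree-sdeg∈ []       zero v≢r = ⊥-elim (v≢r refl)
hubTree-sdeg∈ (w ∷ ws) v    v≢r with HubStep.embed-or-leaf w ws v
... | inj₂ (_ , inj₁ v↦1)  = here v↦1
... | inj₂ (_ , inj₂ v↦-1) = there (here v↦-1)
... | inj₁ (zero , refl)   = there (there (here (HubStep.sdeg-hub w ws)))
... | inj₁ (suc u , refl)  = subst (_∈ 1ℤ ∷ -1ℤ ∷ w ∷ ws) (≡-sym (HubStep.sdeg-embed w ws u≢r))
                               (∈-++-insert (1ℤ ∷ -1ℤ ∷ []) (hubTree-sdeg∈ ws u u≢r))
  where
  u≢r : u ≢ hubRoot ws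
  u≢r refl = v≢r refl

hubTree-realizer : ∀ ws {x} → x ∈ ws → ∃ λ v → v ≢ hubRoot ws × sdeg (hubTree ws) v ≡ x
hubTree-realizer (w ∷ ws) (here refl) =
  HubStep.hub w ws , (λ ()) ∘ HubStep.embed-injective w ws , HubStep.sdeg-hub w ws
hubTree-realizer (w ∷ ws) (there x∈ws) with hubTree-realizer ws x∈ws
... | v , v≢r , v↦x = HubStep.embed w ws (suc v) ,
  (λ e → v≢r (suc-injective (HubStep.embed-injective w ws e))) ,
  trans (HubStep.sdeg-embed w ws v≢r) v↦x

hubTree-radius2 : ∀ ws v → Graph.Dist≤ (hubTree ws) v (hubRoot ws) 2
hubTree-radius2 []       zero = 0 , z≤n , nil
hubTree-radius2 (w ∷ ws) = HubStep.radius2 w ws (hubTree-radius2 ws)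

module Witness (ws : List ℤ) (z₁ : ℤ) where
  private
    signs : List Sign
    signs = leafSigns (z₁ - ℤ.+ length ws)
    D : List ℤ
    D = 1ℤ ∷ -1ℤ ∷ z₁ ∷ ws
    open SetDegree (hubTree ws) (hubRoot ws) (ℤ.+ length ws) z₁
      using (old; old-or-leaf; leaf-of-sign; lift-Adj; lift-Dist≤; sdeg-old; sdeg-target; rankedTree)

  tree : SignedGraph (length signs ℕ.+ hubTreeSize ws)
  tree = SetDegree.graph (hubTree ws) (hubRoot ws) (ℤ.+ length ws) z₁

  open Graph tree using (Dist≤; Adj⇒Dist≤1; Dist≤-mono)

  root : Fin (length signs ℕ.+ hubTreeSize ws)
  root = old signs (hubRoot ws)

  sdeg-root : sdeg tree root ≡ z₁
  sdeg-root = sdeg-target (sdeg-hubRoot ws)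

  isTree : IsTree tree
  isTree = rankedTree⇒isTree tree (rankedTree signs (hubTree-rankedTree ws)) root

  realizes : Realizes tree D
  realizes x = mk⇔ realizer λ (v , v↦x) → subst (_∈ D) v↦x (sdeg∈ v)
    where
    realizer : x ∈ D → ∃ λ v → sdeg tree v ≡ x
    realizer (here refl) with leaf-of-sign signs (here refl)
    ... | v , _ , v↦1 = v , v↦1
    realizer (there (here refl)) with leaf-of-sign signs (there (here refl))
    ... | v , _ , v↦-1 = v , v↦-1
    realizer (there (there (here refl))) = root , sdeg-root
    realizer (there (there (there x∈ws))) with hubTree-realizer ws x∈ws
    ... | v , v≢r , v↦x = old signs v , trans (sdeg-old signs v≢r) v↦x
    sdeg∈ : ∀ v → sdeg tree v ∈ D
    sdeg∈ v with old-or-leaf signs v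
    ... | inj₂ (_ , inj₁ v↦1)  = here v↦1
    ... | inj₂ (_ , inj₂ v↦-1) = there (here v↦-1)
    ... | inj₁ (u , refl) with u ≟ hubRoot ws
    ...   | yes refl = there (there (here sdeg-root))
    ...   | no u≢r   = subst (_∈ D) (≡-sym (sdeg-old signs u≢r))
                         (∈-++-insert (1ℤ ∷ -1ℤ ∷ []) (hubTree-sdeg∈ ws u u≢r))

  embed : Fin (hubTreeSize ws) → Fin (length signs ℕ.+ hubTreeSize ws)
  embed = old signs

  embed-Adj : ∀ {u v} → Adj (hubTree ws) u v → Adj tree (embed u) (embed v)
  embed-Adj = lift-Adj signs

  radius : ∀ {e} → 1 ≤ e → (∀ u → Graph.Dist≤ (hubTree ws) u (hubRoot ws) e) → ∀ v → Dist≤ v root e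
  radius 1≤e near v with old-or-leaf signs v
  ... | inj₂ (v-root , _) = Dist≤-mono 1≤e (Adj⇒Dist≤1 v-root)
  ... | inj₁ (u , refl)   = lift-Dist≤ signs (near u)

  near-centres : ∀ {a} → (∀ u → Graph.Dist≤ (hubTree ws) u a 1 ⊎ Graph.Dist≤ (hubTree ws) u (hubRoot ws) 1) →
                 ∀ v → Dist≤ v (embed a) 1 ⊎ Dist≤ v root 1
  near-centres near v with old-or-leaf signs v
  ... | inj₂ (v-root , _) = inj₂ (Adj⇒Dist≤1 v-root)
  ... | inj₁ (u , refl)   = Sum.map (lift-Dist≤ signs) (lift-Dist≤ signs) (near u)

hubTree-centres : ∀ w u → Graph.Dist≤ (hubTree (w ∷ [])) u (HubStep.hub w []) 1 ⊎
                          Graph.Dist≤ (hubTree (w ∷ [])) u (hubRoot (w ∷ [])) 1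
hubTree-centres w u with HubStep.embed-or-leaf w [] u
... | inj₂ (u-hub , _)       = inj₁ (Graph.Adj⇒Dist≤1 (hubTree (w ∷ [])) u-hub)
... | inj₁ (zero , refl)     = inj₁ (0 , z≤n , nil)
... | inj₁ (suc zero , refl) = inj₂ (0 , z≤n , nil)

diamIs : ∀ {D d k} (G : SignedGraph k) → IsTree G → Realizes G D → Graph.DiamAtMost G (suc d) →
         (∀ {k′} (G′ : SignedGraph k′) {e} → IsTree G′ → Realizes G′ D → Graph.DiamAtMost G′ e → suc d ≤ e) →
         DiamIs D (suc d)
diamIs G tree realizes diam≤ lower =
  (_ , G , tree , realizes ,
   Graph.hasDiameter G _ diam≤ λ diam≤d → ℕₚ.<-irrefl refl (lower G tree realizes diam≤d)) ,
  λ _ G′ _ tree′ realizes′ hasDiameter′ → lower G′ tree′ realizes′ (proj₁ hasDiameter′)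

diamIs-one : ∀ z₁ → NonUnit z₁ → DiamIs (1ℤ ∷ -1ℤ ∷ z₁ ∷ []) 2
diamIs-one z₁ nu₁ =
  diamIs tree isTree realizes (radius⇒diamAtMost (radius ℕₚ.≤-refl λ { zero → 0 , z≤n , nil }))
    λ G′ tree′ realizes′ → LowerBound.2≤diam tree′ realizes′ (here refl) (there (there (here refl))) nu₁
  where
  open Witness [] z₁
  open Graph tree

diamIs-two : ∀ z₁ z₂ → z₁ ≢ z₂ → NonUnit z₁ → NonUnit z₂ → DiamIs (1ℤ ∷ -1ℤ ∷ z₁ ∷ z₂ ∷ []) 3
diamIs-two z₁ z₂ z₁≢z₂ nu₁ nu₂ =
  diamIs tree isTree realizes
    (two-centres⇒diamAtMost3 (embed-Adj (HubStep.hub-adj-root z₂ [])) (near-centres (hubTree-centres z₂)))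
    λ G′ tree′ realizes′ → LowerBound.3≤diam tree′ realizes′ (here refl)
      (there (there (here refl))) (there (there (there (here refl)))) z₁≢z₂ nu₁ nu₂
  where
  open Witness (z₂ ∷ []) z₁
  open Graph tree

diamIs-many : ∀ z₁ z₂ z₃ ws → z₁ ≢ z₂ → z₁ ≢ z₃ → z₂ ≢ z₃ → NonUnit z₁ → NonUnit z₂ → NonUnit z₃ →
              DiamIs (1ℤ ∷ -1ℤ ∷ z₁ ∷ z₂ ∷ z₃ ∷ ws) 4
diamIs-many z₁ z₂ z₃ ws z₁≢z₂ z₁≢z₃ z₂≢z₃ nu₁ nu₂ nu₃ =
  diamIs tree isTree realizes (radius⇒diamAtMost (radius (s≤s z≤n) (hubTree-radius2 (z₂ ∷ z₃ ∷ ws))))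
    λ G′ tree′ realizes′ → LowerBound.4≤diam tree′ realizes′ (here refl)
      (there (there (here refl))) (there (there (there (here refl))))
      (there (there (there (there (here refl)))))
      z₁≢z₂ z₁≢z₃ z₂≢z₃ nu₁ nu₂ nu₃
  where
  open Witness (z₂ ∷ z₃ ∷ ws) z₁
  open Graph tree

mainTheorem6 : (n : ℕ) (z : Fin n → ℤ) → 1 ≤ n →
    (∀ i j → z i ≡ z j → i ≡ j) →
    (∀ i → (z i ≢ 1ℤ) × (z i ≢ -1ℤ)) →
    (n ≡ 1 → DiamIs (1ℤ ∷ -1ℤ ∷ toList z) 2) ×
    (n ≡ 2 → DiamIs (1ℤ ∷ -1ℤ ∷ toList z) 3) ×
    (3 ≤ n → DiamIs (1ℤ ∷ -1ℤ ∷ toList z) 4)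
mainTheorem6 zero _ () _ _
mainTheorem6 1 z _ _ nonUnit =
  (λ _ → diamIs-one (z zero) (nonUnit zero)) , (λ ()) , λ { (s≤s ()) }
mainTheorem6 2 z _ z-injective nonUnit =
  (λ ()) ,
  (λ _ → diamIs-two (z zero) (z (suc zero))
           ((λ ()) ∘ z-injective zero (suc zero))
           (nonUnit zero) (nonUnit (suc zero))) ,
  λ { (s≤s (s≤s ())) }
mainTheorem6 (suc (suc (suc m))) z _ z-injective nonUnit =
  (λ ()) , (λ ()) ,
  λ _ → diamIs-many (z zero) (z (suc zero)) (z (suc (suc zero))) _
          ((λ ()) ∘ z-injective zero (suc zero))
          ((λ ()) ∘ z-injective zero (suc (suc zero)))
          ((λ ()) ∘ z-injective (suc zero) (suc (suc zero)))
          (nonUnit zero) (nonUnit (suc zero)) (nonUnit (suc (suc zero)))
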